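{- Let $r\geq1$, let $G$ be an extraspecial $2$-group of order $2^{2r+1}$ with centre $Z$, suppose $\{Zg_1,\ldots,Zg_{2r}\}$ ($g_i\in G$) is a symmetric basis of $G/Z$ with respect to the quadratic form $Q(Zx)=x^2$, and let $S=\{g_1,\ldots,g_{2r}\}$. Then the Cayley graph $\Gamma=\mathrm{Cay}(G,S)$ is $2$-arc-transitive.
   Context: An extraspecial $2$-group of order $2^{2r+1}$ is a $2$-group $G$ with $|Z(G)|=2$ and $G/Z(G)\cong\mathbb{Z}_2^{2r}$. Identifying $Z$ with $\mathbb{F}_2$, $Q(Zx)=x^2$ is a quadratic form on $G/Z$ with associated bilinear form $B(Zx,Zy)=[x,y]$. A basis is symmetric if $Q(v_i)=0$ for all $i$ and $B(v_i,v_j)=1$ for $i<j$ (so the $g_i$ are involutions). $\mathrm{Cay}(G,S)$ has vertex set $G$ and edges $\{x,sx\}$, $x\in G$, $s\in S$. An $s$-arc is a sequence $(v_1,\ldots,v_{s+1})$ with consecutive vertices adjacent and $v_i\ne v_{i+2}$; the graph is $2$-arc-transitive if its automorphism group is transitive on $2$-arcs. -}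

module Defs where

open import Level using (0ℓ)
open import Algebra.Bundles using (Group)
open import Data.Nat using (ℕ; suc; _*_; _^_; _≥_)
open import Data.Fin using (Fin; zero; suc; _<_)
open import Data.Bool using (Bool; true; false; _xor_)
open import Data.Vec using (Vec; []; _∷_; zipWith; replicate)
open import Data.Product using (Σ; ∃; _×_; _,_)
open import Data.Sum using (_⊎_)
open import Relation.Binary.PropositionalEquality using (_≡_)
open import Relation.Nullary using (¬_)
open import Function using (_∘_)

module _ (G : Group 0ℓ 0ℓ) where
  open Group G

  HasOrder : ℕ → Set
  HasOrder N = Σ (Fin N → Carrier) λ e →
    (∀ i j → e i ≈ e j → i ≡ j) × (∀ x → ∃ λ i → e i ≈ x)

  Central : Carrier → Set
  Central x = ∀ y → x ∙ y ≈ y ∙ x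

  comm : Carrier → Carrier → Carrier
  comm x y = ((x ⁻¹ ∙ y ⁻¹) ∙ x) ∙ y

  CentreIsOrder2With : Carrier → Set
  CentreIsOrder2With z =
    Central z × ¬ (z ≈ ε) × (∀ c → Central c → (c ≈ ε) ⊎ (c ≈ z))

  -- G/Z(G) ≅ ℤ₂^n, given by a surjective homomorphism G → (ℤ₂)^n
  -- (bit vectors under xor) whose kernel is exactly Z(G).
  QuotientByCentreElemAb : ℕ → Set
  QuotientByCentreElemAb n = Σ (Carrier → Vec Bool n) λ φ →
    (∀ x y → x ≈ y → φ x ≡ φ y) ×
    (∀ x y → φ (x ∙ y) ≡ zipWith _xor_ (φ x) (φ y)) ×
    (∀ v → ∃ λ x → φ x ≡ v) ×
    (∀ x → (φ x ≡ replicate _ false → Central x) × (Central x → φ x ≡ replicate _ false))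

  ExtraspecialWith : ℕ → Carrier → Set
  ExtraspecialWith r z =
    HasOrder (2 ^ suc (2 * r)) × CentreIsOrder2With z × QuotientByCentreElemAb (2 * r)

  pow : Bool → Carrier → Carrier
  pow true  x = x
  pow false x = ε

  prod : ∀ {n} → (Fin n → Carrier) → Vec Bool n → Carrier
  prod g []      = ε
  prod g (b ∷ e) = pow b (g zero) ∙ prod (g ∘ suc) e

  -- {Z g₁, …, Z gₙ} is a basis of the F₂-space G/Z:
  -- spanning (every coset Zx equals Z g₁^{e₁}⋯gₙ^{eₙ}) and
  -- linear independence (Z g₁^{e₁}⋯gₙ^{eₙ} = Z only for e = 0).
  IsBasisModCentre : ∀ {n} → (Fin n → Carrier) → Set
  IsBasisModCentre {n} g =
    (∀ x → ∃ λ e → Central (x ∙ prod g e ⁻¹)) ×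
    (∀ e → Central (prod g e) → e ≡ replicate n false)

  -- symmetric basis w.r.t. Q(Zx) = x², B(Zx,Zy) = [x,y], identifying
  -- Z = {ε, z} with F₂ via ε ↦ 0, z ↦ 1:
  -- Q(Zgᵢ) = 0 and B(Zgᵢ, Zgⱼ) = 1 for i < j.
  IsSymmetricBasis : ∀ {n} → Carrier → (Fin n → Carrier) → Set
  IsSymmetricBasis z g =
    IsBasisModCentre g ×
    (∀ i → g i ∙ g i ≈ ε) ×
    (∀ i j → i < j → comm (g i) (g j) ≈ z)

  Adj : ∀ {n} → (Fin n → Carrier) → Carrier → Carrier → Set
  Adj g x y = ∃ λ i → y ≈ g i ∙ x

  IsAutomorphism : ∀ {n} → (Fin n → Carrier) → (Carrier → Carrier) → Set
  IsAutomorphism g f =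
    (∀ x y → x ≈ y → f x ≈ f y) ×
    (∀ x y → f x ≈ f y → x ≈ y) ×
    (∀ y → ∃ λ x → f x ≈ y) ×
    (∀ x y → (Adj g x y → Adj g (f x) (f y)) × (Adj g (f x) (f y) → Adj g x y))

  Is2Arc : ∀ {n} → (Fin n → Carrier) → Carrier → Carrier → Carrier → Set
  Is2Arc g a b c = Adj g a b × Adj g b c × ¬ (a ≈ c)

  TwoArcTransitive : ∀ {n} → (Fin n → Carrier) → Set
  TwoArcTransitive g = ∀ a b c a' b' c' →
    Is2Arc g a b c → Is2Arc g a' b' c' →
    ∃ λ f → IsAutomorphism g f × (f a ≈ a') × (f b ≈ b') × (f c ≈ c')

{-# OPTIONS --safe #-}
-- G / Z is an 𝔽₂-space carrying the commutator form B (x, y) = [x, y], and the gᵢ are involutions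
-- with B (gᵢ, gⱼ) = 1 for i ≠ j. For i ≠ j put w = gᵢ gⱼ, so w² = [gᵢ, gⱼ] = z, and
-- h = gⱼ g₁ ⋯ g₂ᵣ, so B (gₖ, h) = δₖⱼ because 2r − 1 is odd. Then x ↦ x w^B(x,w) z^B(x,h) is an involutive
-- automorphism of G swapping gᵢ and gⱼ and fixing the other generators. Automorphisms of G permuting
-- S are graph automorphisms fixing 1, so the stabiliser of 1 contains a copy of Sym(2r) acting on the
-- 2-arcs (1, gᵢ, gⱼ gᵢ) as on ordered pairs of distinct indices, i.e. transitively; right translations
-- move any 2-arc to one starting at 1.
module Submission where

open import Defs
open import Level using (0ℓ)
open import Algebra.Bundles using (Group)
open import Data.Nat using (ℕ; zero; suc; _*_; _≥_)
open import Data.Nat.Properties using (*-suc)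
open import Data.Fin using (Fin; zero; suc; _≟_; _<_)
open import Data.Fin.Properties using (<-cmp; suc-injective)
open import Data.Fin.Permutation.Components using (transpose; transpose-inverse)
open import Data.Bool using (Bool; true; false; not; _xor_; _∧_)
open import Data.Bool.Properties
  using (xor-same; xor-comm; xor-assoc; xor-identityˡ; xor-identityʳ; not-involutive; ∧-zeroʳ; ∧-identityʳ)
open import Data.Vec using (Vec; []; _∷_; zipWith; replicate)
open import Data.Vec.Properties using (zipWith-assoc; zipWith-comm; zipWith-identityˡ)
open import Data.Product using (∃; ∃₂; _×_; _,_; proj₁; proj₂)
open import Data.Sum using (_⊎_; inj₁; inj₂)
open import Data.Empty using (⊥-elim)
open import Function using (_∘_; id)
open import Relation.Binary using (tri<; tri≈; tri>)
open import Relation.Binary.PropositionalEquality as ≡ using (_≡_; _≢_; subst; subst₂)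
open import Relation.Nullary using (¬_; yes; no)
open import Relation.Nullary.Decidable using (dec-true; dec-false)

transpose-matchˡ : ∀ {m} (i j : Fin m) → transpose i j i ≡ j
transpose-matchˡ i j rewrite dec-true (i ≟ i) ≡.refl = ≡.refl

transpose-matchʳ : ∀ {m} {i j : Fin m} → i ≢ j → transpose i j j ≡ i
transpose-matchʳ {i = i} {j} i≢j
  rewrite dec-false (j ≟ i) (i≢j ∘ ≡.sym) | dec-true (j ≟ j) ≡.refl = ≡.refl

transpose-other : ∀ {m} {i j k : Fin m} → k ≢ i → k ≢ j → transpose i j k ≡ k
transpose-other {i = i} {j} {k} k≢i k≢j
  rewrite dec-false (k ≟ i) k≢i | dec-false (k ≟ j) k≢j = ≡.refl

-- Split on i ≟ k rather than k ≟ i: abstracting k ≟ i would also rewrite inside transpose.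
transpose-same : ∀ {m} (i k : Fin m) → transpose i i k ≡ k
transpose-same i k with i ≟ k
... | yes ≡.refl = transpose-matchˡ i i
... | no i≢k = transpose-other (i≢k ∘ ≡.sym) (i≢k ∘ ≡.sym)

transpose-injective : ∀ {m} (i j : Fin m) {k l} → transpose i j k ≡ transpose i j l → k ≡ l
transpose-injective i j {k} {l} e =
  ≡.trans (≡.sym (transpose-inverse j i)) (≡.trans (≡.cong (transpose j i) e) (transpose-inverse j i))

odd : ℕ → Bool
odd zero    = false
odd (suc m) = not (odd m)

odd-double : ∀ r → odd (2 * r) ≡ false
odd-double zero = ≡.refl
odd-double (suc r) =
  ≡.trans (≡.cong odd (*-suc 2 r)) (≡.trans (not-involutive (odd (2 * r))) (odd-double r))

zipWith-xor-same : ∀ {m} (u : Vec Bool m) → zipWith _xor_ u u ≡ replicate m false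
zipWith-xor-same []      = ≡.refl
zipWith-xor-same (b ∷ u) = ≡.cong₂ _∷_ (xor-same b) (zipWith-xor-same u)

zipWith-xor-identityʳ-unique : ∀ {m} (u v : Vec Bool m) → zipWith _xor_ u v ≡ u → v ≡ replicate m false
zipWith-xor-identityʳ-unique u v u⊕v≡u = begin
  v                                          ≡⟨ ≡.sym (zipWith-identityˡ xor-identityˡ v) ⟩
  zipWith _xor_ (replicate _ false) v         ≡⟨ ≡.cong (λ e → zipWith _xor_ e v) (≡.sym (zipWith-xor-same u)) ⟩
  zipWith _xor_ (zipWith _xor_ u u) v         ≡⟨ zipWith-assoc xor-assoc u u v ⟩
  zipWith _xor_ u (zipWith _xor_ u v)         ≡⟨ ≡.cong (zipWith _xor_ u) u⊕v≡u ⟩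
  zipWith _xor_ u u                           ≡⟨ zipWith-xor-same u ⟩
  replicate _ false                           ∎
  where open ≡.≡-Reasoning

module Commutators (G : Group 0ℓ 0ℓ) where
  open Group G
  open import Algebra.Properties.Group G using (identityʳ-unique; inverseˡ-unique; ∙-cancelˡ)
  open import Algebra.Solver.Monoid monoid using (solve; _⊜_; _⊕_)
  open import Relation.Binary.Reasoning.Setoid setoid

  central-ε : Central G ε
  central-ε y = trans (identityˡ y) (sym (identityʳ y))

  central-∙ : ∀ {a b} → Central G a → Central G b → Central G (a ∙ b)
  central-∙ {a} {b} ca cb y = begin
    (a ∙ b) ∙ y  ≈⟨ assoc a b y ⟩
    a ∙ (b ∙ y)  ≈⟨ ∙-congˡ (cb y) ⟩
    a ∙ (y ∙ b)  ≈⟨ assoc a y b ⟨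
    (a ∙ y) ∙ b  ≈⟨ ∙-congʳ (ca y) ⟩
    (y ∙ a) ∙ b  ≈⟨ assoc y a b ⟩
    y ∙ (a ∙ b)  ∎

  central-swap : ∀ {c} → Central G c → ∀ a b → (a ∙ c) ∙ b ≈ (a ∙ b) ∙ c
  central-swap {c} cc a b = begin
    (a ∙ c) ∙ b  ≈⟨ assoc a c b ⟩
    a ∙ (c ∙ b)  ≈⟨ ∙-congˡ (cc b) ⟩
    a ∙ (b ∙ c)  ≈⟨ assoc a b c ⟨
    (a ∙ b) ∙ c  ∎

  comm-cong : ∀ {x x′ y y′} → x ≈ x′ → y ≈ y′ → comm G x y ≈ comm G x′ y′
  comm-cong x≈x′ y≈y′ = ∙-cong (∙-cong (∙-cong (⁻¹-cong x≈x′) (⁻¹-cong y≈y′)) x≈x′) y≈y′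

  ∙-reorder : ∀ x y → x ∙ y ≈ (y ∙ x) ∙ comm G x y
  ∙-reorder x y = sym (begin
    (y ∙ x) ∙ (((x ⁻¹ ∙ y ⁻¹) ∙ x) ∙ y)
      ≈⟨ solve 6 (λ y x x⁻ y⁻ x′ y′ → (y ⊕ x) ⊕ (((x⁻ ⊕ y⁻) ⊕ x′) ⊕ y′)
                                     ⊜ y ⊕ ((x ⊕ x⁻) ⊕ (y⁻ ⊕ (x′ ⊕ y′))))
               refl y x (x ⁻¹) (y ⁻¹) x y ⟩
    y ∙ ((x ∙ x ⁻¹) ∙ (y ⁻¹ ∙ (x ∙ y)))  ≈⟨ ∙-congˡ (trans (∙-congʳ (inverseʳ x)) (identityˡ _)) ⟩
    y ∙ (y ⁻¹ ∙ (x ∙ y))                ≈⟨ assoc y (y ⁻¹) (x ∙ y) ⟨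
    (y ∙ y ⁻¹) ∙ (x ∙ y)                ≈⟨ trans (∙-congʳ (inverseʳ y)) (identityˡ _) ⟩
    x ∙ y                               ∎)

  comm-self : ∀ x → comm G x x ≈ ε
  comm-self x = identityʳ-unique (x ∙ x) _ (sym (∙-reorder x x))

  comm-centralˡ : ∀ {x} y → Central G x → comm G x y ≈ ε
  comm-centralˡ {x} y cx = identityʳ-unique (y ∙ x) _ (trans (sym (∙-reorder x y)) (cx y))

  comm-swap : ∀ x y → comm G y x ≈ comm G x y ⁻¹
  comm-swap x y = inverseˡ-unique _ _ (identityʳ-unique (x ∙ y) _ (sym (begin
    x ∙ y                                   ≈⟨ ∙-reorder x y ⟩
    (y ∙ x) ∙ comm G x y                    ≈⟨ ∙-congʳ (∙-reorder y x) ⟩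
    ((x ∙ y) ∙ comm G y x) ∙ comm G x y     ≈⟨ assoc _ _ _ ⟩
    (x ∙ y) ∙ (comm G y x ∙ comm G x y)     ∎)))

  -- Move u to the left of x y in one step, or past y and then past x, and compare.
  comm-∙ˡ : ∀ x y u → Central G (comm G x u) →
            comm G (x ∙ y) u ≈ comm G x u ∙ comm G y u
  comm-∙ˡ x y u central-xu = ∙-cancelˡ (u ∙ (x ∙ y)) _ _ (begin
    (u ∙ (x ∙ y)) ∙ comm G (x ∙ y) u        ≈⟨ ∙-reorder (x ∙ y) u ⟨
    (x ∙ y) ∙ u                             ≈⟨ assoc x y u ⟩
    x ∙ (y ∙ u)                             ≈⟨ ∙-congˡ (∙-reorder y u) ⟩
    x ∙ ((u ∙ y) ∙ comm G y u)
      ≈⟨ solve 4 (λ x u y c → x ⊕ ((u ⊕ y) ⊕ c) ⊜ ((x ⊕ u) ⊕ y) ⊕ c) refl x u y _ ⟩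
    ((x ∙ u) ∙ y) ∙ comm G y u              ≈⟨ ∙-congʳ (∙-congʳ (∙-reorder x u)) ⟩
    (((u ∙ x) ∙ comm G x u) ∙ y) ∙ comm G y u  ≈⟨ ∙-congʳ (central-swap central-xu (u ∙ x) y) ⟩
    (((u ∙ x) ∙ y) ∙ comm G x u) ∙ comm G y u
      ≈⟨ solve 5 (λ u x y c d → (((u ⊕ x) ⊕ y) ⊕ c) ⊕ d ⊜ (u ⊕ (x ⊕ y)) ⊕ (c ⊕ d)) refl u x y _ _ ⟩
    (u ∙ (x ∙ y)) ∙ (comm G x u ∙ comm G y u)  ∎)

  comm-involutions : ∀ {x y} → x ∙ x ≈ ε → y ∙ y ≈ ε → comm G x y ≈ (x ∙ y) ∙ (x ∙ y)
  comm-involutions {x} {y} x²≈ε y²≈ε = begin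
    ((x ⁻¹ ∙ y ⁻¹) ∙ x) ∙ y  ≈⟨ ∙-congʳ (∙-congʳ (∙-cong (sym (inverseˡ-unique x x x²≈ε))
                                                         (sym (inverseˡ-unique y y y²≈ε)))) ⟩
    ((x ∙ y) ∙ x) ∙ y        ≈⟨ assoc (x ∙ y) x y ⟩
    (x ∙ y) ∙ (x ∙ y)        ∎

module _ (G : Group 0ℓ 0ℓ) where
  open Group G
  open Commutators G using (∙-reorder)
  open ≡.≡-Reasoning

  -- φ (x y) = φ (y x) in the abelian target, while x y = (y x) [x,y].
  commutators-central : ∀ {m} (φ : Carrier → Vec Bool m) →
    (∀ x y → x ≈ y → φ x ≡ φ y) →
    (∀ x y → φ (x ∙ y) ≡ zipWith _xor_ (φ x) (φ y)) →
    (∀ x → φ x ≡ replicate m false → Central G x) →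
    ∀ x y → Central G (comm G x y)
  commutators-central φ φ-cong φ-homo kernel-central x y =
    kernel-central _ (zipWith-xor-identityʳ-unique (φ (y ∙ x)) (φ (comm G x y)) (begin
      zipWith _xor_ (φ (y ∙ x)) (φ (comm G x y))  ≡⟨ ≡.sym (φ-homo (y ∙ x) (comm G x y)) ⟩
      φ ((y ∙ x) ∙ comm G x y)                   ≡⟨ φ-cong _ _ (sym (∙-reorder x y)) ⟩
      φ (x ∙ y)                                  ≡⟨ φ-homo x y ⟩
      zipWith _xor_ (φ x) (φ y)                  ≡⟨ zipWith-comm xor-comm (φ x) (φ y) ⟩
      zipWith _xor_ (φ y) (φ x)                  ≡⟨ ≡.sym (φ-homo y x) ⟩
      φ (y ∙ x)                                  ∎))

module CayleyGraph (G : Group 0ℓ 0ℓ) {n : ℕ} (g : Fin n → Group.Carrier G) where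
  open Group G
  open import Algebra.Properties.Group G using (identityˡ-unique; ∙-cancelʳ; //-rightDividesˡ; \\-leftDividesˡ)
  open import Relation.Binary.Reasoning.Setoid setoid

  id-isAutomorphism : IsAutomorphism G g id
  id-isAutomorphism = (λ _ _ → id) , (λ _ _ → id) , (λ y → y , refl) , (λ _ _ → id , id)

  ∘-isAutomorphism : ∀ {f₁ f₂} → IsAutomorphism G g f₁ → IsAutomorphism G g f₂ →
                     IsAutomorphism G g (f₂ ∘ f₁)
  ∘-isAutomorphism (f₁-cong , f₁-inj , f₁-surj , f₁-adj) (f₂-cong , f₂-inj , f₂-surj , f₂-adj) =
    (λ x y → f₂-cong _ _ ∘ f₁-cong x y) ,
    (λ x y → f₁-inj x y ∘ f₂-inj _ _) ,
    (λ y → let (x₁ , f₂x₁≈y) = f₂-surj y ; (x , f₁x≈x₁) = f₁-surj x₁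
           in x , trans (f₂-cong _ _ f₁x≈x₁) f₂x₁≈y) ,
    (λ x y → proj₁ (f₂-adj _ _) ∘ proj₁ (f₁-adj x y) , proj₂ (f₁-adj x y) ∘ proj₂ (f₂-adj _ _))

  ∙ʳ-isAutomorphism : ∀ t → IsAutomorphism G g (_∙ t)
  ∙ʳ-isAutomorphism t =
    (λ _ _ → ∙-congʳ) ,
    (λ x y → ∙-cancelʳ t x y) ,
    (λ y → y ∙ t ⁻¹ , //-rightDividesˡ t y) ,
    (λ x y → (λ (k , y≈gkx) → k , trans (∙-congʳ y≈gkx) (assoc (g k) x t)) ,
             (λ (k , yt≈gkxt) → k , ∙-cancelʳ t y (g k ∙ x) (trans yt≈gkxt (sym (assoc (g k) x t)))))

  record Induces (π : Fin n → Fin n) (f : Carrier → Carrier) : Set where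
    field
      cong          : ∀ {x y} → x ≈ y → f x ≈ f y
      homo          : ∀ x y → f (x ∙ y) ≈ f x ∙ f y
      involutive    : ∀ x → f (f x) ≈ x
      on-generators : ∀ k → f (g k) ≈ g (π k)

    fixes-ε : f ε ≈ ε
    fixes-ε = identityˡ-unique (f ε) (f ε) (trans (sym (homo ε ε)) (cong (identityˡ ε)))

    relabels : ∀ k x → f (g k ∙ x) ≈ g (π k) ∙ f x
    relabels k x = trans (homo (g k) x) (∙-congʳ (on-generators k))

  induces⇒isAutomorphism : ∀ {π f} → Induces π f → IsAutomorphism G g f
  induces⇒isAutomorphism {π} {f} ind =
    (λ _ _ → cong) ,
    (λ x y fx≈fy → trans (sym (involutive x)) (trans (cong fx≈fy) (involutive y))) ,
    (λ y → f y , involutive y) ,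
    (λ x y → (λ (k , y≈gkx) → π k , trans (cong y≈gkx) (relabels k x)) ,
             (λ (k , fy≈gkfx) → π k , (begin
                y                    ≈⟨ involutive y ⟨
                f (f y)              ≈⟨ cong fy≈gkfx ⟩
                f (g k ∙ f x)        ≈⟨ relabels k (f x) ⟩
                g (π k) ∙ f (f x)    ≈⟨ ∙-congˡ (involutive x) ⟩
                g (π k) ∙ x          ∎)))
    where open Induces ind

  Triple : Set
  Triple = Carrier × Carrier × Carrier

  _≋_ : Triple → Triple → Set
  (a , b , c) ≋ (a′ , b′ , c′) = a ≈ a′ × b ≈ b′ × c ≈ c′

  ≋-sym : ∀ {s t} → s ≋ t → t ≋ s
  ≋-sym {_ , _ , _} {_ , _ , _} (a≈ , b≈ , c≈) = sym a≈ , sym b≈ , sym c≈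

  _⟶_ : Triple → Triple → Set
  (a , b , c) ⟶ t = ∃ λ f → IsAutomorphism G g f × (f a , f b , f c) ≋ t

  ≋⇒⟶ : ∀ {s t} → s ≋ t → s ⟶ t
  ≋⇒⟶ {_ , _ , _} {_ , _ , _} s≋t = id , id-isAutomorphism , s≋t

  ⟶-trans : ∀ {s t u} → s ⟶ t → t ⟶ u → s ⟶ u
  ⟶-trans {_ , _ , _} {_ , _ , _} {_ , _ , _}
          (f₁ , aut₁ , a≈ , b≈ , c≈) (f₂ , aut₂ , a≈′ , b≈′ , c≈′) =
    f₂ ∘ f₁ , ∘-isAutomorphism aut₁ aut₂ ,
    trans (f₂-cong _ _ a≈) a≈′ , trans (f₂-cong _ _ b≈) b≈′ , trans (f₂-cong _ _ c≈) c≈′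
    where
      f₂-cong : ∀ x y → x ≈ y → f₂ x ≈ f₂ y
      f₂-cong = proj₁ aut₂

  path : Carrier → Fin n → Fin n → Triple
  path x i j = x , g i ∙ x , g j ∙ (g i ∙ x)

  path-cong : ∀ {x y} i j → x ≈ y → path x i j ≋ path y i j
  path-cong i j x≈y = x≈y , ∙-congˡ x≈y , ∙-congˡ (∙-congˡ x≈y)

  path-∙ʳ : ∀ x t i j → path x i j ⟶ path (x ∙ t) i j
  path-∙ʳ x t i j =
    _∙ t , ∙ʳ-isAutomorphism t ,
    refl , assoc (g i) x t , trans (assoc (g j) (g i ∙ x) t) (∙-congˡ (assoc (g i) x t))

  path-transport : ∀ x y i j → path x i j ⟶ path y i j
  path-transport x y i j = ⟶-trans (path-∙ʳ x (x ⁻¹ ∙ y) i j) (≋⇒⟶ (path-cong i j (\\-leftDividesˡ x y)))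

  induces⇒path : ∀ {π f} → Induces π f → ∀ i j → path ε i j ⟶ path ε (π i) (π j)
  induces⇒path {π} {f} ind i j =
    f , induces⇒isAutomorphism ind , fixes-ε , f-gᵢ , trans (relabels j (g i ∙ ε)) (∙-congˡ f-gᵢ)
    where
      open Induces ind
      f-gᵢ : f (g i ∙ ε) ≈ g (π i) ∙ ε
      f-gᵢ = trans (relabels i ε) (∙-congˡ fixes-ε)

  2-arc⇒path : (∀ i → g i ∙ g i ≈ ε) → ∀ {a b c} → Is2Arc G g a b c →
               ∃₂ λ i j → i ≢ j × (a , b , c) ≋ path a i j
  2-arc⇒path g-involutive {a} {b} {c} ((i , b≈gᵢa) , (j , c≈gⱼb) , a≉c) =
    i , j , i≢j , refl , b≈gᵢa , trans c≈gⱼb (∙-congˡ b≈gᵢa)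
    where
      i≢j : i ≢ j
      i≢j ≡.refl = a≉c (sym (begin
        c                ≈⟨ c≈gⱼb ⟩
        g i ∙ b          ≈⟨ ∙-congˡ b≈gᵢa ⟩
        g i ∙ (g i ∙ a)  ≈⟨ assoc (g i) (g i) a ⟨
        (g i ∙ g i) ∙ a  ≈⟨ ∙-congʳ (g-involutive i) ⟩
        ε ∙ a            ≈⟨ identityˡ a ⟩
        a                ∎))

  module _ (transposition-induced : ∀ k l → ∃ (Induces (transpose k l))) where

    -- Move i to i′ by the first transposition; the second fixes i′ and moves the image of j to j′.
    stabiliser-transitive : ∀ {i j i′ j′} → i ≢ j → i′ ≢ j′ → path ε i j ⟶ path ε i′ j′
    stabiliser-transitive {i} {j} {i′} {j′} i≢j i′≢j′ = ⟶-trans step₁ step₂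
      where
        induced-path : ∀ k l i j → path ε i j ⟶ path ε (transpose k l i) (transpose k l j)
        induced-path k l = induces⇒path (proj₂ (transposition-induced k l))

        j₁ : Fin n
        j₁ = transpose i i′ j

        i′≢j₁ : i′ ≢ j₁
        i′≢j₁ i′≡j₁ = i≢j (transpose-injective i i′ (≡.trans (transpose-matchˡ i i′) i′≡j₁))

        step₁ : path ε i j ⟶ path ε i′ j₁
        step₁ = subst (λ k → path ε i j ⟶ path ε k j₁) (transpose-matchˡ i i′) (induced-path i i′ i j)

        step₂ : path ε i′ j₁ ⟶ path ε i′ j′
        step₂ = subst₂ (λ k l → path ε i′ j₁ ⟶ path ε k l)
                       (transpose-other i′≢j₁ i′≢j′) (transpose-matchˡ j₁ j′) (induced-path j₁ j′ i′ j₁)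

    twoArcTransitive : (∀ i → g i ∙ g i ≈ ε) → TwoArcTransitive G g
    twoArcTransitive g-involutive a b c a′ b′ c′ arc arc′
      with 2-arc⇒path g-involutive arc | 2-arc⇒path g-involutive arc′
    ... | i , j , i≢j , arc≋path | i′ , j′ , i′≢j′ , arc′≋path =
      ⟶-trans (≋⇒⟶ arc≋path) (⟶-trans (path-transport a ε i j)
        (⟶-trans (stabiliser-transitive i≢j i′≢j′)
          (⟶-trans (path-transport ε a′ i′ j′) (≋⇒⟶ (≋-sym arc′≋path)))))

module CommutatorForm (G : Group 0ℓ 0ℓ) (z : Group.Carrier G) (centre : CentreIsOrder2With G z)
                      (comm-central : ∀ x y → Central G (comm G x y)) where
  open Group G
  open Commutators G
  open import Algebra.Properties.Group G using (identityʳ-unique; inverseˡ-unique)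
  open import Algebra.Solver.Monoid monoid using (solve; _⊜_; _⊕_)
  open import Relation.Binary.Reasoning.Setoid setoid

  private
    z-central : Central G z
    z-central = proj₁ centre

    z≉ε : ¬ z ≈ ε
    z≉ε = proj₁ (proj₂ centre)

    central⇒ε⊎z : ∀ c → Central G c → c ≈ ε ⊎ c ≈ z
    central⇒ε⊎z = proj₂ (proj₂ centre)

  z∙z≈ε : z ∙ z ≈ ε
  z∙z≈ε with central⇒ε⊎z (z ∙ z) (central-∙ z-central z-central)
  ... | inj₁ z∙z≈ε = z∙z≈ε
  ... | inj₂ z∙z≈z = ⊥-elim (z≉ε (identityʳ-unique z z z∙z≈z))

  Z : Bool → Carrier
  Z b = pow G b z

  Z-central : ∀ b → Central G (Z b)
  Z-central false = central-ε
  Z-central true  = z-central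

  Z-∙ : ∀ a b → Z a ∙ Z b ≈ Z (a xor b)
  Z-∙ false b     = identityˡ (Z b)
  Z-∙ true  false = identityʳ z
  Z-∙ true  true  = z∙z≈ε

  Z-self : ∀ a → Z a ∙ Z a ≈ ε
  Z-self false = identityˡ ε
  Z-self true  = z∙z≈ε

  Z-injective : ∀ {a b} → Z a ≈ Z b → a ≡ b
  Z-injective {false} {false} _ = ≡.refl
  Z-injective {false} {true}  ε≈z = ⊥-elim (z≉ε (sym ε≈z))
  Z-injective {true}  {false} z≈ε = ⊥-elim (z≉ε z≈ε)
  Z-injective {true}  {true}  _ = ≡.refl

  Z-≡ : ∀ {a b} → a ≡ b → Z a ≈ Z b
  Z-≡ a≡b = reflexive (≡.cong Z a≡b)

  ∙-Z : ∀ a b p q → (a ∙ Z p) ∙ (b ∙ Z q) ≈ (a ∙ b) ∙ Z (p xor q)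
  ∙-Z a b p q = begin
    (a ∙ Z p) ∙ (b ∙ Z q)    ≈⟨ assoc (a ∙ Z p) b (Z q) ⟨
    ((a ∙ Z p) ∙ b) ∙ Z q    ≈⟨ ∙-congʳ (central-swap (Z-central p) a b) ⟩
    ((a ∙ b) ∙ Z p) ∙ Z q    ≈⟨ assoc (a ∙ b) (Z p) (Z q) ⟩
    (a ∙ b) ∙ (Z p ∙ Z q)    ≈⟨ ∙-congˡ (Z-∙ p q) ⟩
    (a ∙ b) ∙ Z (p xor q)    ∎

  B : Carrier → Carrier → Bool
  B x y with central⇒ε⊎z (comm G x y) (comm-central x y)
  ... | inj₁ _ = false
  ... | inj₂ _ = true

  B-spec : ∀ x y → comm G x y ≈ Z (B x y)
  B-spec x y with central⇒ε⊎z (comm G x y) (comm-central x y)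
  ... | inj₁ [x,y]≈ε = [x,y]≈ε
  ... | inj₂ [x,y]≈z = [x,y]≈z

  B-unique : ∀ {x y b} → comm G x y ≈ Z b → B x y ≡ b
  B-unique {x} {y} [x,y]≈Zb = Z-injective (trans (sym (B-spec x y)) [x,y]≈Zb)

  B-cong : ∀ {x x′ y y′} → x ≈ x′ → y ≈ y′ → B x y ≡ B x′ y′
  B-cong {x′ = x′} {y′ = y′} x≈x′ y≈y′ = B-unique (trans (comm-cong x≈x′ y≈y′) (B-spec x′ y′))

  ∙-reorderᴮ : ∀ x y → x ∙ y ≈ (y ∙ x) ∙ Z (B x y)
  ∙-reorderᴮ x y = trans (∙-reorder x y) (∙-congˡ (B-spec x y))

  B-self : ∀ x → B x x ≡ false
  B-self x = B-unique (comm-self x)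

  B-centralˡ : ∀ {x} y → Central G x → B x y ≡ false
  B-centralˡ y cx = B-unique (comm-centralˡ y cx)

  B-linearˡ : ∀ x y u → B (x ∙ y) u ≡ B x u xor B y u
  B-linearˡ x y u = B-unique (begin
    comm G (x ∙ y) u             ≈⟨ comm-∙ˡ x y u (comm-central x u) ⟩
    comm G x u ∙ comm G y u      ≈⟨ ∙-cong (B-spec x u) (B-spec y u) ⟩
    Z (B x u) ∙ Z (B y u)        ≈⟨ Z-∙ (B x u) (B y u) ⟩
    Z (B x u xor B y u)          ∎)

  B-sym : ∀ x y → B y x ≡ B x y
  B-sym x y = B-unique (begin
    comm G y x             ≈⟨ comm-swap x y ⟩
    comm G x y ⁻¹          ≈⟨ ⁻¹-cong (B-spec x y) ⟩
    Z (B x y) ⁻¹           ≈⟨ inverseˡ-unique _ _ (Z-self (B x y)) ⟨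
    Z (B x y)              ∎)

  B-linearʳ : ∀ u x y → B u (x ∙ y) ≡ B u x xor B u y
  B-linearʳ u x y =
    ≡.trans (B-sym (x ∙ y) u) (≡.trans (B-linearˡ x y u) (≡.cong₂ _xor_ (B-sym u x) (B-sym u y)))

  B-identityʳ : ∀ x → B x ε ≡ false
  B-identityʳ x = ≡.trans (B-sym ε x) (B-centralˡ x central-ε)

  B-pow : ∀ b v u → B (pow G b v) u ≡ b ∧ B v u
  B-pow false v u = B-centralˡ u central-ε
  B-pow true  v u = ≡.refl

  B-prod-allTrue : ∀ {m} (h : Fin m → Carrier) a → (∀ k → B a (h k) ≡ true) →
                   B a (prod G h (replicate m true)) ≡ odd m
  B-prod-allTrue {zero} h a _ = B-identityʳ a
  B-prod-allTrue {suc m} h a all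
    rewrite B-linearʳ a (h zero) (prod G (h ∘ suc) (replicate m true))
          | all zero | B-prod-allTrue (h ∘ suc) a (all ∘ suc) = ≡.refl

  B-prod-allTrue-but : ∀ {m} (h : Fin m → Carrier) a k₀ → B a (h k₀) ≡ false →
                       (∀ k → k ≢ k₀ → B a (h k) ≡ true) →
                       B a (prod G h (replicate m true)) ≡ not (odd m)
  B-prod-allTrue-but {suc m} h a zero k₀-false others
    rewrite B-linearʳ a (h zero) (prod G (h ∘ suc) (replicate m true))
          | k₀-false | B-prod-allTrue (h ∘ suc) a (λ k → others (suc k) λ ())
          = ≡.sym (not-involutive (odd m))
  B-prod-allTrue-but {suc m} h a (suc k₀) k₀-false others
    rewrite B-linearʳ a (h zero) (prod G (h ∘ suc) (replicate m true))
          | others zero (λ ())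
          | B-prod-allTrue-but (h ∘ suc) a k₀ k₀-false (λ k k≢k₀ → others (suc k) (k≢k₀ ∘ suc-injective))
          = ≡.refl

  -- For w with w² = z, the map x ↦ x w^B(x,w) lifts the transvection v ↦ v + B(v,w) w of G / Z;
  -- the correction z^B(x,h) with B(w,h) = 1 makes it an involution.
  module Transvection (w h : Carrier) (w∙w≈z : w ∙ w ≈ z) (B-w-h : B w h ≡ true) where

    W : Bool → Carrier
    W β = pow G β w

    τ : Carrier → Carrier
    τ x = (x ∙ W (B x w)) ∙ Z (B x h)

    τ-unfold : ∀ {x β γ} → B x w ≡ β → B x h ≡ γ → τ x ≈ (x ∙ W β) ∙ Z γ
    τ-unfold ≡.refl ≡.refl = refl

    τ-cong : ∀ {x y} → x ≈ y → τ x ≈ τ y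
    τ-cong x≈y = ∙-cong (∙-cong x≈y (reflexive (≡.cong W (B-cong x≈y refl)))) (Z-≡ (B-cong x≈y refl))

    W-∙ : ∀ β β′ → W β ∙ W β′ ≈ W (β xor β′) ∙ Z (β ∧ β′)
    W-∙ false false = refl
    W-∙ false true  = trans (identityˡ w) (sym (identityʳ w))
    W-∙ true  false = refl
    W-∙ true  true  = trans w∙w≈z (sym (identityˡ z))

    W-self : ∀ β → W β ∙ W β ≈ Z β
    W-self false = identityˡ ε
    W-self true  = w∙w≈z

    W-swap : ∀ β y → W β ∙ y ≈ (y ∙ W β) ∙ Z (β ∧ B y w)
    W-swap false y = trans (identityˡ y) (sym (trans (identityʳ _) (identityʳ y)))
    W-swap true  y = trans (∙-reorderᴮ w y) (∙-congˡ (Z-≡ (B-sym y w)))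

    -- The central factor Z (β ∧ B y w) from commuting W β past y cancels the one from W β ∙ W (B y w).
    W-collect : ∀ x y β → (x ∙ W β) ∙ (y ∙ W (B y w)) ≈ (x ∙ y) ∙ W (β xor B y w)
    W-collect x y β = begin
      (x ∙ W β) ∙ (y ∙ W β′)
        ≈⟨ solve 4 (λ x a y b → (x ⊕ a) ⊕ (y ⊕ b) ⊜ x ⊕ ((a ⊕ y) ⊕ b)) refl x (W β) y (W β′) ⟩
      x ∙ ((W β ∙ y) ∙ W β′)                 ≈⟨ ∙-congˡ (∙-congʳ (W-swap β y)) ⟩
      x ∙ (((y ∙ W β) ∙ C) ∙ W β′)           ≈⟨ ∙-congˡ (central-swap (Z-central (β ∧ β′)) (y ∙ W β) (W β′)) ⟩
      x ∙ (((y ∙ W β) ∙ W β′) ∙ C)           ≈⟨ ∙-congˡ (∙-congʳ (trans (assoc y _ _) (∙-congˡ (W-∙ β β′)))) ⟩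
      x ∙ ((y ∙ (W (β xor β′) ∙ C)) ∙ C)
        ≈⟨ solve 4 (λ x y a c → x ⊕ ((y ⊕ (a ⊕ c)) ⊕ c) ⊜ (x ⊕ y) ⊕ (a ⊕ (c ⊕ c)))
                   refl x y (W (β xor β′)) C ⟩
      (x ∙ y) ∙ (W (β xor β′) ∙ (C ∙ C))     ≈⟨ ∙-congˡ (trans (∙-congˡ (Z-self (β ∧ β′))) (identityʳ _)) ⟩
      (x ∙ y) ∙ W (β xor β′)                 ∎
      where
        β′ : Bool
        β′ = B y w
        C : Carrier
        C = Z (β ∧ β′)

    τ-homo : ∀ x y → τ (x ∙ y) ≈ τ x ∙ τ y
    τ-homo x y = sym (begin
      ((x ∙ W (B x w)) ∙ Z (B x h)) ∙ ((y ∙ W (B y w)) ∙ Z (B y h))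
        ≈⟨ ∙-Z (x ∙ W (B x w)) (y ∙ W (B y w)) (B x h) (B y h) ⟩
      ((x ∙ W (B x w)) ∙ (y ∙ W (B y w))) ∙ Z (B x h xor B y h)
        ≈⟨ ∙-congʳ (W-collect x y (B x w)) ⟩
      ((x ∙ y) ∙ W (B x w xor B y w)) ∙ Z (B x h xor B y h)
        ≈⟨ τ-unfold (B-linearˡ x y w) (B-linearˡ x y h) ⟨
      τ (x ∙ y)                                                        ∎)

    B-τ : ∀ x u → B (τ x) u ≡ B x u xor (B x w ∧ B w u)
    B-τ x u = ≡.trans (B-linearˡ (x ∙ W β) (Z (B x h)) u) (≡.trans
      (≡.cong₂ _xor_ (B-linearˡ x (W β) u) (B-centralˡ u (Z-central (B x h))))
      (≡.trans (xor-identityʳ _) (≡.cong (B x u xor_) (B-pow β w u))))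
      where
        β : Bool
        β = B x w

    τ-involutive : ∀ x → τ (τ x) ≈ x
    τ-involutive x = begin
      τ (τ x)                                  ≈⟨ τ-unfold B-τx-w B-τx-h ⟩
      (((x ∙ W β) ∙ Z γ) ∙ W β) ∙ Z (γ xor β)  ≈⟨ ∙-congʳ (central-swap (Z-central γ) (x ∙ W β) (W β)) ⟩
      (((x ∙ W β) ∙ W β) ∙ Z γ) ∙ Z (γ xor β)  ≈⟨ assoc _ (Z γ) _ ⟩
      ((x ∙ W β) ∙ W β) ∙ (Z γ ∙ Z (γ xor β))  ≈⟨ ∙-cong (trans (assoc x _ _) (∙-congˡ (W-self β)))
                                                        (trans (Z-∙ γ _) (Z-≡ (γ-cancel γ))) ⟩
      (x ∙ Z β) ∙ Z β                         ≈⟨ assoc x (Z β) (Z β) ⟩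
      x ∙ (Z β ∙ Z β)                         ≈⟨ trans (∙-congˡ (Z-self β)) (identityʳ x) ⟩
      x                                       ∎
      where
        β γ : Bool
        β = B x w
        γ = B x h

        B-τx-w : B (τ x) w ≡ β
        B-τx-w = ≡.trans (B-τ x w) (≡.trans (≡.cong (λ b → β xor (β ∧ b)) (B-self w))
                                            (≡.trans (≡.cong (β xor_) (∧-zeroʳ β)) (xor-identityʳ β)))

        B-τx-h : B (τ x) h ≡ γ xor β
        B-τx-h = ≡.trans (B-τ x h) (≡.trans (≡.cong (λ b → γ xor (β ∧ b)) B-w-h)
                                            (≡.cong (γ xor_) (∧-identityʳ β)))

        γ-cancel : ∀ γ → γ xor (γ xor β) ≡ β
        γ-cancel γ = ≡.trans (≡.sym (xor-assoc γ γ β)) (≡.cong (_xor β) (xor-same γ))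

  module SymmetricBasis {n} (g : Fin n → Carrier) (g-involutive : ∀ i → g i ∙ g i ≈ ε)
                        (g-comm : ∀ i j → i < j → comm G (g i) (g j) ≈ z) (n-even : odd n ≡ false) where
    open CayleyGraph G g using (Induces)

    B-generators : ∀ {k l} → k ≢ l → B (g k) (g l) ≡ true
    B-generators {k} {l} k≢l with <-cmp k l
    ... | tri< k<l _ _ = B-unique (g-comm k l k<l)
    ... | tri≈ _ k≡l _ = ⊥-elim (k≢l k≡l)
    ... | tri> _ _ l<k = ≡.trans (B-sym (g l) (g k)) (B-unique (g-comm l k l<k))

    H : Carrier
    H = prod G g (replicate n true)

    -- B (g k, H) counts the n − 1 generators other than g k, an odd number.
    B-H : ∀ k → B (g k) H ≡ true
    B-H k = ≡.trans (B-prod-allTrue-but g (g k) k (B-self (g k)) (λ l l≢k → B-generators (l≢k ∘ ≡.sym)))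
                    (≡.cong not n-even)

    module Transposition {i j : Fin n} (i≢j : i ≢ j) where
      w h : Carrier
      w = g i ∙ g j
      h = g j ∙ H

      w∙w≈z : w ∙ w ≈ z
      w∙w≈z = trans (sym (comm-involutions (g-involutive i) (g-involutive j)))
                    (trans (B-spec (g i) (g j)) (Z-≡ (B-generators i≢j)))

      B-h : ∀ k → B (g k) h ≡ not (B (g k) (g j))
      B-h k = ≡.trans (B-linearʳ (g k) (g j) H)
                      (≡.trans (≡.cong (B (g k) (g j) xor_) (B-H k)) (xor-comm _ true))

      B-w-h : B w h ≡ true
      B-w-h rewrite B-linearˡ (g i) (g j) h | B-h i | B-h j | B-generators i≢j | B-self (g j) = ≡.refl

      open Transvection w h w∙w≈z B-w-h public

      τ-gᵢ : τ (g i) ≈ g j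
      τ-gᵢ = begin
        τ (g i)                      ≈⟨ τ-unfold B-gᵢ-w B-gᵢ-h ⟩
        (g i ∙ (g i ∙ g j)) ∙ ε      ≈⟨ identityʳ _ ⟩
        g i ∙ (g i ∙ g j)            ≈⟨ assoc (g i) (g i) (g j) ⟨
        (g i ∙ g i) ∙ g j            ≈⟨ trans (∙-congʳ (g-involutive i)) (identityˡ (g j)) ⟩
        g j                          ∎
        where
          B-gᵢ-w : B (g i) w ≡ true
          B-gᵢ-w rewrite B-linearʳ (g i) (g i) (g j) | B-self (g i) | B-generators i≢j = ≡.refl
          B-gᵢ-h : B (g i) h ≡ false
          B-gᵢ-h rewrite B-h i | B-generators i≢j = ≡.refl

      τ-gₖ : ∀ {k} → k ≢ i → k ≢ j → τ (g k) ≈ g k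
      τ-gₖ {k} k≢i k≢j = trans (τ-unfold B-gₖ-w B-gₖ-h) (trans (identityʳ _) (identityʳ (g k)))
        where
          B-gₖ-w : B (g k) w ≡ false
          B-gₖ-w rewrite B-linearʳ (g k) (g i) (g j) | B-generators k≢i | B-generators k≢j = ≡.refl
          B-gₖ-h : B (g k) h ≡ false
          B-gₖ-h rewrite B-h k | B-generators k≢j = ≡.refl

      τ-generator : ∀ k → τ (g k) ≈ g (transpose i j k)
      τ-generator k with i ≟ k | j ≟ k
      ... | yes ≡.refl | _ = trans τ-gᵢ (reflexive (≡.cong g (≡.sym (transpose-matchˡ i j))))
      ... | no _ | yes ≡.refl =
        trans (τ-cong (sym τ-gᵢ))
              (trans (τ-involutive (g i)) (reflexive (≡.cong g (≡.sym (transpose-matchʳ i≢j)))))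
      ... | no i≢k | no j≢k = trans (τ-gₖ k≢i k≢j) (reflexive (≡.cong g (≡.sym (transpose-other k≢i k≢j))))
        where
          k≢i : k ≢ i
          k≢i = i≢k ∘ ≡.sym
          k≢j : k ≢ j
          k≢j = j≢k ∘ ≡.sym

      τ-induces : Induces (transpose i j) τ
      τ-induces = record
        { cong = τ-cong ; homo = τ-homo ; involutive = τ-involutive ; on-generators = τ-generator }

    transposition-induced : ∀ k l → ∃ (Induces (transpose k l))
    transposition-induced k l with k ≟ l
    ... | yes ≡.refl = id , record
      { cong = id ; homo = λ _ _ → refl ; involutive = λ _ → refl
      ; on-generators = λ m → reflexive (≡.cong g (≡.sym (transpose-same k m))) }
    ... | no k≢l = Transposition.τ k≢l , Transposition.τ-induces k≢l

theorem4p2 : (r : ℕ) → r ≥ 1 → (G : Group 0ℓ 0ℓ) → (z : Group.Carrier G) →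
    ExtraspecialWith G r z →
    (g : Fin (2 * r) → Group.Carrier G) → IsSymmetricBasis G z g →
    TwoArcTransitive G g
theorem4p2 r _ G z (_ , centre , φ , φ-cong , φ-homo , _ , kernel) g (_ , g-involutive , g-comm) =
  CayleyGraph.twoArcTransitive G g (SymmetricBasis.transposition-induced g g-involutive g-comm (odd-double r))
                               g-involutive
  where
    open CommutatorForm G z centre (commutators-central G φ φ-cong φ-homo (proj₁ ∘ kernel))
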